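{- Let $a$ be a real number and $n$ a positive integer. Then, as identities in the variables $x,y$: (i) $\frac a2\big(E_{n,a}(x+1)+E_{n,a}(x-1)\big)+(1-a)E_{n,a}(x)=x^n$; (ii) $\sum_{k=0}^n\binom nk E_{n-k,a}(x)\Big\{\frac a2\big((y+1)^k+(y-1)^k\big)+(1-a)y^k\Big\}=(x+y)^n$; (iii) $E_{n,a}(x)=x^n-a\sum_{k=1}^{\lfloor n/2\rfloor}\binom n{2k}E_{n-2k,a}(x)$.
   Context: For a real number $a$, the sequence $\{E_{n,a}\}$ is defined by $E_{0,a}=1$ and $E_{n,a}=-a\sum_{k=1}^{\lfloor n/2\rfloor}\binom{n}{2k}E_{n-2k,a}$ for $n\ge 1$, and the polynomials $E_{n,a}(x)$ are defined by $E_{n,a}(x)=\sum_{k=0}^n\binom nk E_{k,a}x^{n-k}$ for $n\ge 0$. -}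

module Defs where

open import Level using (Level)
open import Data.Nat.Base using (ℕ; zero; suc; _∸_; ⌊_/2⌋)
open import Data.Nat.Combinatorics using (_C_)
open import Algebra.Bundles using (CommutativeRing)

module _ {c ℓ : Level} (R : CommutativeRing c ℓ) where
  open CommutativeRing R

  fromℕ : ℕ → Carrier
  fromℕ zero    = 0#
  fromℕ (suc n) = 1# + fromℕ n

  pow : Carrier → ℕ → Carrier
  pow x zero    = 1#
  pow x (suc n) = x * pow x n

  Σ₁ : ℕ → (ℕ → Carrier) → Carrier
  Σ₁ zero    f = 0#
  Σ₁ (suc m) f = Σ₁ m f + f (suc m)

  Σ₀ : ℕ → (ℕ → Carrier) → Carrier
  Σ₀ m f = f 0 + Σ₁ m f

  binom : ℕ → ℕ → Carrier
  binom n k = fromℕ (n C k)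

  -- With fuel ≥ n+1 the recursion never runs out of fuel (each recursive call
  -- is at an index ≤ n-2 with one less fuel), so Eseq below is exactly E_{n,a}.
  Efuel : Carrier → ℕ → ℕ → Carrier
  Efuel a zero       n       = 0#
  Efuel a (suc fuel) zero    = 1#
  Efuel a (suc fuel) (suc m) =
    - (a * Σ₁ ⌊ suc m /2⌋ (λ k → binom (suc m) (k ℕ.+ k) * Efuel a fuel (suc m ∸ (k ℕ.+ k))))
    where import Data.Nat.Base as ℕ

  Eseq : Carrier → ℕ → Carrier
  Eseq a n = Efuel a (suc n) n

  Epoly : Carrier → ℕ → Carrier → Carrier
  Epoly a n x = Σ₀ n (λ k → binom n k * (Eseq a k * pow x (n ∸ k)))

module Submission where

-- Everything happens in an arbitrary commutative ring R; the
-- factor 1/2 of the paper is an element h with h + h = 1.  For sequences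
-- f g : ℕ → R let f ⋆ g be their binomial convolution
--     (f ⋆ g) n = Σ_{k=0}^{n} C(n,k) f(k) g(n-k),
-- i.e. the product of exponential generating functions.  Then
--   * ⋆ is bilinear, commutative and associative with unit δ = (1,0,0,…);
--   * the binomial theorem reads  x^• ⋆ y^• = (x+y)^•;
--   * the polynomial E_{n,a}(x) is, by definition, (E_a ⋆ x^•)(n);
--   * the recursion defining E_{n,a} says exactly  c_a ⋆ E_a = δ, where
--       c_a(k) = a·[k even] + (1-a)·[k = 0],  and  [k even] = h(1^k + (-1)^k).
-- Hence c_a ⋆ (E_a ⋆ g) = g for every sequence g.  Identity (i) is this for
-- g = x^•, after expanding E_{n,a}(x±1) with the binomial theorem; (ii) is the
-- same fact convolved with y^•; and (iii) is it at index n ≥ 1 with the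
-- convolution c_a ⋆ F written out as F(n) + a Σ_k C(n,2k) F(n-2k).

open import Defs
open import Level using (Level)
open import Data.Nat.Base as ℕ using (ℕ; zero; suc; s≤s)
import Data.Nat.Properties as ℕₚ
open import Data.Nat.Combinatorics using (_C_; nCk+nC[k+1]≡[n+1]C[k+1])
open import Data.Nat.Combinatorics.Specification using (k>n⇒nCk≡0)
open import Data.Product using (_×_; _,_)
open import Algebra.Bundles using (CommutativeRing)
import Relation.Binary.PropositionalEquality as P

module Development {c ℓ : Level} (R : CommutativeRing c ℓ) where
  open CommutativeRing R
  open import Algebra.Properties.Ring ring using (-1*x≈-x; -‿involutive)
  open import Algebra.Solver.Ring.NaturalCoefficients.Default commutativeSemiring
  open import Relation.Binary.Reasoning.Setoid setoid

  Σ₁-cong : ∀ n {f g : ℕ → Carrier} → (∀ k → k ℕ.< n → f (suc k) ≈ g (suc k)) →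
            Σ₁ R n f ≈ Σ₁ R n g
  Σ₁-cong zero    f≈g = refl
  Σ₁-cong (suc n) f≈g =
    +-cong (Σ₁-cong n (λ k k<n → f≈g k (ℕₚ.m<n⇒m<1+n k<n))) (f≈g n (ℕₚ.n<1+n n))

  Σ₀-cong : ∀ n {f g : ℕ → Carrier} → (∀ k → f k ≈ g k) → Σ₀ R n f ≈ Σ₀ R n g
  Σ₀-cong n f≈g = +-cong (f≈g 0) (Σ₁-cong n (λ k _ → f≈g (suc k)))

  Σ₁-+ : ∀ n (f g : ℕ → Carrier) → Σ₁ R n (λ k → f k + g k) ≈ Σ₁ R n f + Σ₁ R n g
  Σ₁-+ zero    f g = sym (+-identityˡ 0#)
  Σ₁-+ (suc n) f g = trans (+-congʳ (Σ₁-+ n f g))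
    (solve 4 (λ a b c d → (a :+ b) :+ (c :+ d) := (a :+ c) :+ (b :+ d)) refl _ _ _ _)

  Σ₀-+ : ∀ n (f g : ℕ → Carrier) → Σ₀ R n (λ k → f k + g k) ≈ Σ₀ R n f + Σ₀ R n g
  Σ₀-+ n f g = trans (+-congˡ (Σ₁-+ n f g))
    (solve 4 (λ a b c d → (a :+ b) :+ (c :+ d) := (a :+ c) :+ (b :+ d)) refl _ _ _ _)

  Σ₁-* : ∀ n a (f : ℕ → Carrier) → Σ₁ R n (λ k → a * f k) ≈ a * Σ₁ R n f
  Σ₁-* zero    a f = sym (zeroʳ a)
  Σ₁-* (suc n) a f = trans (+-congʳ (Σ₁-* n a f)) (sym (distribˡ _ _ _))

  Σ₀-* : ∀ n a (f : ℕ → Carrier) → Σ₀ R n (λ k → a * f k) ≈ a * Σ₀ R n f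
  Σ₀-* n a f = trans (+-congˡ (Σ₁-* n a f)) (sym (distribˡ _ _ _))

  Σ₁-suc : ∀ n (f : ℕ → Carrier) → Σ₁ R (suc n) f ≈ Σ₀ R n (λ k → f (suc k))
  Σ₁-suc zero    f = trans (+-identityˡ _) (sym (+-identityʳ _))
  Σ₁-suc (suc n) f = trans (+-congʳ (Σ₁-suc n f)) (+-assoc _ _ _)

  -- Binomial coefficients in R: C(n,0) = 1, Pascal's rule, C(n,n+1) = 0.
  -- They are images of natural numbers, so Pascal's rule needs fromℕ additive.
  fromℕ-+ : ∀ m n → fromℕ R (m ℕ.+ n) ≈ fromℕ R m + fromℕ R n
  fromℕ-+ zero    n = sym (+-identityˡ _)
  fromℕ-+ (suc m) n = trans (+-congˡ (fromℕ-+ m n)) (sym (+-assoc _ _ _))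

  binom-zero : ∀ n → binom R n 0 ≈ 1#
  binom-zero n = +-identityʳ 1#

  binom-pascal : ∀ n k → binom R (suc n) (suc k) ≈ binom R n k + binom R n (suc k)
  binom-pascal n k = trans (reflexive (P.cong (fromℕ R) (P.sym (nCk+nC[k+1]≡[n+1]C[k+1] n k))))
                           (fromℕ-+ (n C k) (n C suc k))

  binom-over : ∀ n → binom R n (suc n) ≈ 0#
  binom-over n = reflexive (P.cong (fromℕ R) (k>n⇒nCk≡0 (ℕₚ.n<1+n n)))

  -- The binomial convolution of sequences (product of exponential
  -- generating functions).  Note that Epoly R a n x is (Eseq R a ⋆ pow R x) n.

  Seq : Set c
  Seq = ℕ → Carrier

  infixl 7 _⋆_
  _⋆_ : Seq → Seq → Seq
  (f ⋆ g) n = Σ₀ R n (λ k → binom R n k * (f k * g (n ℕ.∸ k)))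

  -- The shifted sequence k ↦ f (k+1), i.e. the derivative of the e.g.f.
  shift : Seq → Seq
  shift f k = f (suc k)

  ⋆-cong : ∀ {f f′ g g′} → (∀ k → f k ≈ f′ k) → (∀ k → g k ≈ g′ k) →
           ∀ n → (f ⋆ g) n ≈ (f′ ⋆ g′) n
  ⋆-cong f≈f′ g≈g′ n = Σ₀-cong n (λ k → *-congˡ (*-cong (f≈f′ k) (g≈g′ (n ℕ.∸ k))))

  ⋆-distribˡ : ∀ f g h n → (f ⋆ (λ k → g k + h k)) n ≈ (f ⋆ g) n + (f ⋆ h) n
  ⋆-distribˡ f g h n = trans
    (Σ₀-cong n (λ k → solve 4 (λ b x y z → b :* (x :* (y :+ z)) := b :* (x :* y) :+ b :* (x :* z)) refl _ _ _ _))
    (Σ₀-+ n _ _)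

  ⋆-distribʳ : ∀ f g h n → ((λ k → f k + g k) ⋆ h) n ≈ (f ⋆ h) n + (g ⋆ h) n
  ⋆-distribʳ f g h n = trans
    (Σ₀-cong n (λ k → solve 4 (λ b x y z → b :* ((x :+ y) :* z) := b :* (x :* z) :+ b :* (y :* z)) refl _ _ _ _))
    (Σ₀-+ n _ _)

  ⋆-scaleˡ : ∀ a f g n → ((λ k → a * f k) ⋆ g) n ≈ a * (f ⋆ g) n
  ⋆-scaleˡ a f g n = trans
    (Σ₀-cong n (λ k → solve 4 (λ b a x y → b :* ((a :* x) :* y) := a :* (b :* (x :* y))) refl _ _ _ _))
    (Σ₀-* n _ _)

  ⋆-scaleʳ : ∀ f a g n → (f ⋆ (λ k → a * g k)) n ≈ a * (f ⋆ g) n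
  ⋆-scaleʳ f a g n = trans
    (Σ₀-cong n (λ k → solve 4 (λ b x a y → b :* (x :* (a :* y)) := a :* (b :* (x :* y))) refl _ _ _ _))
    (Σ₀-* n _ _)

  -- Leibniz rule: shift (f ⋆ g) = shift f ⋆ g + f ⋆ shift g.  Proved from
  -- Pascal's rule; it drives every inductive argument about ⋆ below.
  ⋆-suc : ∀ f g n → (f ⋆ g) (suc n) ≈ (shift f ⋆ g) n + (f ⋆ shift g) n
  ⋆-suc f g n = begin
      φ 0 + Σ₁ R (suc n) φ
    ≈⟨ +-congˡ (Σ₁-suc n φ) ⟩
      φ 0 + Σ₀ R n (shift φ)
    ≈⟨ +-congˡ (Σ₀-cong n (λ j → trans (*-congʳ (binom-pascal n j)) (distribʳ _ _ _))) ⟩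
      φ 0 + Σ₀ R n (λ j → ψ j + χ (suc j))
    ≈⟨ +-congˡ (Σ₀-+ n ψ (shift χ)) ⟩
      φ 0 + ((shift f ⋆ g) n + Σ₀ R n (shift χ))
    ≈⟨ +-congˡ (+-congˡ (sym (Σ₁-suc n χ))) ⟩
      φ 0 + ((shift f ⋆ g) n + (Σ₁ R n χ + χ (suc n)))
    ≈⟨ +-congˡ (+-congˡ (+-cong (Σ₁-cong n χ-inner) χ-last)) ⟩
      φ 0 + ((shift f ⋆ g) n + (Σ₁ R n ω + 0#))
    ≈⟨ solve 4 (λ p x y z → p :+ (x :+ (y :+ z)) := x :+ ((p :+ y) :+ z)) refl _ _ _ _ ⟩
      (shift f ⋆ g) n + ((φ 0 + Σ₁ R n ω) + 0#)
    ≈⟨ +-congˡ (+-identityʳ _) ⟩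
      (shift f ⋆ g) n + (φ 0 + Σ₁ R n ω)
    ≈⟨ +-congˡ (+-congʳ (*-congʳ (trans (binom-zero (suc n)) (sym (binom-zero n))))) ⟩
      (shift f ⋆ g) n + (f ⋆ shift g) n
    ∎
    where
    -- the summands of (f ⋆ g)(n+1), of (shift f ⋆ g)(n) and of (f ⋆ shift g)(n),
    -- and the "second Pascal half" χ, which agrees with ω below index n+1
    φ ψ χ ω : ℕ → Carrier
    φ k = binom R (suc n) k * (f k * g (suc n ℕ.∸ k))
    ψ j = binom R n j * (f (suc j) * g (n ℕ.∸ j))
    χ k = binom R n k * (f k * g (suc n ℕ.∸ k))
    ω k = binom R n k * (f k * g (suc (n ℕ.∸ k)))
    χ-inner : ∀ k → k ℕ.< n → χ (suc k) ≈ ω (suc k)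
    χ-inner k k<n = *-congˡ (*-congˡ (reflexive (P.cong g (ℕₚ.+-∸-assoc 1 k<n))))
    χ-last : χ (suc n) ≈ 0#
    χ-last = trans (*-congʳ (binom-over n)) (zeroˡ _)

  ⋆-comm : ∀ n f g → (f ⋆ g) n ≈ (g ⋆ f) n
  ⋆-comm zero    f g = +-congʳ (*-congˡ (*-comm _ _))
  ⋆-comm (suc n) f g = begin
      (f ⋆ g) (suc n)
    ≈⟨ ⋆-suc f g n ⟩
      (shift f ⋆ g) n + (f ⋆ shift g) n
    ≈⟨ +-cong (⋆-comm n (shift f) g) (⋆-comm n f (shift g)) ⟩
      (g ⋆ shift f) n + (shift g ⋆ f) n
    ≈⟨ +-comm _ _ ⟩
      (shift g ⋆ f) n + (g ⋆ shift f) n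
    ≈⟨ sym (⋆-suc g f n) ⟩
      (g ⋆ f) (suc n)
    ∎

  ⋆-assoc : ∀ n f g h → ((f ⋆ g) ⋆ h) n ≈ (f ⋆ (g ⋆ h)) n
  ⋆-assoc zero f g h =
    solve 4 (λ b x y z → b :* ((b :* (x :* y) :+ con 0) :* z) :+ con 0
                       := b :* (x :* (b :* (y :* z) :+ con 0)) :+ con 0) refl _ _ _ _
  ⋆-assoc (suc n) f g h = begin
      ((f ⋆ g) ⋆ h) (suc n)
    ≈⟨ ⋆-suc (f ⋆ g) h n ⟩
      (shift (f ⋆ g) ⋆ h) n + ((f ⋆ g) ⋆ shift h) n
    ≈⟨ +-congʳ (⋆-cong {g = h} (⋆-suc f g) (λ _ → refl) n) ⟩
      ((λ k → (shift f ⋆ g) k + (f ⋆ shift g) k) ⋆ h) n + ((f ⋆ g) ⋆ shift h) n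
    ≈⟨ +-congʳ (⋆-distribʳ (shift f ⋆ g) (f ⋆ shift g) h n) ⟩
      (((shift f ⋆ g) ⋆ h) n + ((f ⋆ shift g) ⋆ h) n) + ((f ⋆ g) ⋆ shift h) n
    ≈⟨ +-cong (+-cong (⋆-assoc n (shift f) g h) (⋆-assoc n f (shift g) h)) (⋆-assoc n f g (shift h)) ⟩
      ((shift f ⋆ (g ⋆ h)) n + (f ⋆ (shift g ⋆ h)) n) + (f ⋆ (g ⋆ shift h)) n
    ≈⟨ +-assoc _ _ _ ⟩
      (shift f ⋆ (g ⋆ h)) n + ((f ⋆ (shift g ⋆ h)) n + (f ⋆ (g ⋆ shift h)) n)
    ≈⟨ +-congˡ (sym (⋆-distribˡ f (shift g ⋆ h) (g ⋆ shift h) n)) ⟩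
      (shift f ⋆ (g ⋆ h)) n + (f ⋆ (λ k → (shift g ⋆ h) k + (g ⋆ shift h) k)) n
    ≈⟨ +-congˡ (⋆-cong (λ _ → refl) (λ k → sym (⋆-suc g h k)) n) ⟩
      (shift f ⋆ (g ⋆ h)) n + (f ⋆ shift (g ⋆ h)) n
    ≈⟨ sym (⋆-suc f (g ⋆ h) n) ⟩
      (f ⋆ (g ⋆ h)) (suc n)
    ∎

  δ : Seq
  δ zero    = 1#
  δ (suc _) = 0#

  ⋆-identityʳ : ∀ n f → (f ⋆ δ) n ≈ f n
  ⋆-identityʳ zero    f = solve 1 (λ x → (con 1 :+ con 0) :* (x :* con 1) :+ con 0 := x) refl _
  ⋆-identityʳ (suc n) f = begin
      (f ⋆ δ) (suc n)
    ≈⟨ ⋆-suc f δ n ⟩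
      (shift f ⋆ δ) n + (f ⋆ shift δ) n
    ≈⟨ +-cong (⋆-identityʳ n (shift f)) (⋆-cong (λ _ → refl) (λ k → sym (zeroˡ (δ k))) n) ⟩
      f (suc n) + (f ⋆ (λ k → 0# * δ k)) n
    ≈⟨ +-congˡ (trans (⋆-scaleʳ f 0# δ n) (zeroˡ _)) ⟩
      f (suc n) + 0#
    ≈⟨ +-identityʳ _ ⟩
      f (suc n)
    ∎

  ⋆-identityˡ : ∀ n f → (δ ⋆ f) n ≈ f n
  ⋆-identityˡ n f = trans (⋆-comm n δ f) (⋆-identityʳ n f)

  binomial-theorem : ∀ n x y → pow R (x + y) n ≈ (pow R x ⋆ pow R y) n
  binomial-theorem zero    x y = solve 0 (con 1 := (con 1 :+ con 0) :* (con 1 :* con 1) :+ con 0) refl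
  binomial-theorem (suc n) x y = begin
      (x + y) * pow R (x + y) n
    ≈⟨ distribʳ _ _ _ ⟩
      x * pow R (x + y) n + y * pow R (x + y) n
    ≈⟨ +-cong (*-congˡ (binomial-theorem n x y)) (*-congˡ (binomial-theorem n x y)) ⟩
      x * (pow R x ⋆ pow R y) n + y * (pow R x ⋆ pow R y) n
    ≈⟨ sym (+-cong (⋆-scaleˡ x (pow R x) (pow R y) n) (⋆-scaleʳ (pow R x) y (pow R y) n)) ⟩
      (shift (pow R x) ⋆ pow R y) n + (pow R x ⋆ shift (pow R y)) n
    ≈⟨ sym (⋆-suc (pow R x) (pow R y) n) ⟩
      (pow R x ⋆ pow R y) (suc n)
    ∎

  even : Seq
  even zero          = 1#
  even (suc zero)    = 0#
  even (suc (suc k)) = even k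

  even-as-powers : ∀ h → h + h ≈ 1# → ∀ k → h * (pow R 1# k + pow R (- 1#) k) ≈ even k
  even-as-powers h h+h≈1 zero =
    trans (distribˡ _ _ _) (trans (+-cong (*-identityʳ h) (*-identityʳ h)) h+h≈1)
  even-as-powers h h+h≈1 (suc zero) =
    trans (*-congˡ (trans (+-cong (*-identityʳ _) (*-identityʳ _)) (-‿inverseʳ 1#))) (zeroʳ h)
  even-as-powers h h+h≈1 (suc (suc k)) =
    trans (*-congˡ (+-cong (trans (*-identityˡ _) (*-identityˡ _)) minus-one-squared))
          (even-as-powers h h+h≈1 k)
    where
    minus-one-squared : (- 1#) * ((- 1#) * pow R (- 1#) k) ≈ pow R (- 1#) k
    minus-one-squared = trans (-1*x≈-x _) (trans (-‿cong (-1*x≈-x _)) (-‿involutive _))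

  even-pair : ∀ n (g : Seq) → even (suc n) * g (suc n) + even n * g (suc (suc n))
                              ≈ g (suc ℕ.⌊ n /2⌋ ℕ.+ suc ℕ.⌊ n /2⌋)
  even-pair zero          g = trans (+-cong (zeroˡ _) (*-identityˡ _)) (+-identityˡ _)
  even-pair (suc zero)    g = trans (+-cong (*-identityˡ _) (zeroˡ _)) (+-identityʳ _)
  even-pair (suc (suc n)) g = trans (even-pair n (λ k → g (suc (suc k))))
    (reflexive (P.cong (λ m → g (suc m)) (P.sym (ℕₚ.+-suc (suc t) (suc t)))))
    where t = ℕ.⌊ n /2⌋

  Σ-even : ∀ n (g : Seq) → Σ₁ R n (λ m → even m * g m) ≈ Σ₁ R ℕ.⌊ n /2⌋ (λ k → g (k ℕ.+ k))
  Σ-even zero          g = refl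
  Σ-even (suc zero)    g = trans (+-identityˡ _) (zeroˡ _)
  Σ-even (suc (suc n)) g = trans (+-assoc _ _ _) (+-cong (Σ-even n g) (even-pair n g))

  evenSum : ℕ → Seq → Carrier
  evenSum n F = Σ₁ R ℕ.⌊ n /2⌋ (λ k → binom R n (k ℕ.+ k) * F (n ℕ.∸ (k ℕ.+ k)))

  evenSum-cong : ∀ n (F G : Seq) → (∀ k → F (n ℕ.∸ (suc k ℕ.+ suc k)) ≈ G (n ℕ.∸ (suc k ℕ.+ suc k))) →
                 evenSum n F ≈ evenSum n G
  evenSum-cong n F G F≈G = Σ₁-cong ℕ.⌊ n /2⌋ (λ k _ → *-congˡ (F≈G k))

  kernel : Carrier → Seq
  kernel a k = a * even k + (1# + - a) * δ k

  kernel-zero : ∀ a → kernel a 0 ≈ 1#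
  kernel-zero a = begin
      a * 1# + (1# + - a) * 1#
    ≈⟨ +-cong (*-identityʳ _) (*-identityʳ _) ⟩
      a + (1# + - a)
    ≈⟨ solve 3 (λ a o b → a :+ (o :+ b) := o :+ (a :+ b)) refl a 1# (- a) ⟩
      1# + (a + - a)
    ≈⟨ +-congˡ (-‿inverseʳ a) ⟩
      1# + 0#
    ≈⟨ +-identityʳ _ ⟩
      1# ∎

  kernel⋆-suc : ∀ a F m → (kernel a ⋆ F) (suc m) ≈ F (suc m) + a * evenSum (suc m) F
  kernel⋆-suc a F m =
    +-cong leading (trans (Σ₁-cong n inner) (trans (Σ₁-* n a _) (*-congˡ (Σ-even n g))))
    where
    n = suc m
    g : Seq
    g k = binom R n k * F (n ℕ.∸ k)
    leading : binom R n 0 * (kernel a 0 * F n) ≈ F n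
    leading = trans (*-cong (binom-zero n) (*-congʳ (kernel-zero a)))
                    (trans (*-identityˡ _) (*-identityˡ _))
    inner : ∀ k → k ℕ.< n → binom R n (suc k) * (kernel a (suc k) * F (n ℕ.∸ suc k))
                            ≈ a * (even (suc k) * g (suc k))
    inner k _ = trans (*-congˡ (*-congʳ (trans (+-congˡ (zeroʳ _)) (+-identityʳ _))))
      (solve 4 (λ b a p f → b :* ((a :* p) :* f) := a :* (p :* (b :* f))) refl _ _ _ _)

  Efuel-stable : ∀ a f₁ f₂ j → j ℕ.< f₁ → j ℕ.< f₂ → Efuel R a f₁ j ≈ Efuel R a f₂ j
  Efuel-stable a (suc f₁) (suc f₂) zero    _          _          = refl
  Efuel-stable a (suc f₁) (suc f₂) (suc m) (s≤s m<f₁) (s≤s m<f₂) =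
    -‿cong (*-congˡ (evenSum-cong (suc m) (Efuel R a f₁) (Efuel R a f₂)
      (λ k → Efuel-stable a f₁ f₂ _ (below k m<f₁) (below k m<f₂))))
    where
    below : ∀ k {f} → suc m ℕ.≤ f → suc m ℕ.∸ (suc k ℕ.+ suc k) ℕ.< f
    below k m<f = ℕₚ.≤-trans (s≤s (ℕₚ.m∸n≤m m (k ℕ.+ suc k))) m<f

  kernel⋆E : ∀ a k → (kernel a ⋆ Eseq R a) k ≈ δ k
  kernel⋆E a zero =
    trans (+-identityʳ _)
          (trans (*-cong (binom-zero 0) (trans (*-congʳ (kernel-zero a)) (*-identityˡ _))) (*-identityˡ _))
  kernel⋆E a (suc m) = begin
      (kernel a ⋆ E) (suc m)
    ≈⟨ kernel⋆-suc a E m ⟩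
      E (suc m) + a * evenSum (suc m) E
    ≈⟨ +-congʳ (-‿cong (*-congˡ (evenSum-cong (suc m) (Efuel R a (suc m)) E
                 (λ k → Efuel-stable a _ _ _ (below k) (ℕₚ.n<1+n _))))) ⟩
      - (a * evenSum (suc m) E) + a * evenSum (suc m) E
    ≈⟨ -‿inverseˡ _ ⟩
      0# ∎
    where
    E = Eseq R a
    below : ∀ k → suc m ℕ.∸ (suc k ℕ.+ suc k) ℕ.< suc m
    below k = s≤s (ℕₚ.m∸n≤m m (k ℕ.+ suc k))

  kernel⋆E⋆ : ∀ a g n → (kernel a ⋆ (Eseq R a ⋆ g)) n ≈ g n
  kernel⋆E⋆ a g n = begin
      (kernel a ⋆ (Eseq R a ⋆ g)) n ≈⟨ ⋆-assoc n (kernel a) (Eseq R a) g ⟨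
      ((kernel a ⋆ Eseq R a) ⋆ g) n ≈⟨ ⋆-cong {g = g} (kernel⋆E a) (λ _ → refl) n ⟩
      (δ ⋆ g) n                     ≈⟨ ⋆-identityˡ n g ⟩
      g n                           ∎

  ⋆kernel : ∀ h → h + h ≈ 1# → ∀ a G n →
            (a * h) * ((G ⋆ pow R 1#) n + (G ⋆ pow R (- 1#)) n) + (1# + - a) * (G ⋆ δ) n
            ≈ (G ⋆ kernel a) n
  ⋆kernel h h+h≈1 a G n = begin
      (a * h) * ((G ⋆ p₊) n + (G ⋆ p₋) n) + b * (G ⋆ δ) n
    ≈⟨ +-congʳ (*-assoc _ _ _) ⟩
      a * (h * ((G ⋆ p₊) n + (G ⋆ p₋) n)) + b * (G ⋆ δ) n
    ≈⟨ +-congʳ (*-congˡ (*-congˡ (sym (⋆-distribˡ G p₊ p₋ n)))) ⟩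
      a * (h * (G ⋆ (λ k → p₊ k + p₋ k)) n) + b * (G ⋆ δ) n
    ≈⟨ +-congʳ (*-congˡ (sym (⋆-scaleʳ G h (λ k → p₊ k + p₋ k) n))) ⟩
      a * (G ⋆ (λ k → h * (p₊ k + p₋ k))) n + b * (G ⋆ δ) n
    ≈⟨ sym (+-cong (⋆-scaleʳ G a (λ k → h * (p₊ k + p₋ k)) n) (⋆-scaleʳ G b δ n)) ⟩
      (G ⋆ (λ k → a * (h * (p₊ k + p₋ k)))) n + (G ⋆ (λ k → b * δ k)) n
    ≈⟨ sym (⋆-distribˡ G (λ k → a * (h * (p₊ k + p₋ k))) (λ k → b * δ k) n) ⟩
      (G ⋆ (λ k → a * (h * (p₊ k + p₋ k)) + b * δ k)) n
    ≈⟨ ⋆-cong {f = G} (λ _ → refl) (λ k → +-congʳ {x = b * δ k} (*-congˡ (even-as-powers h h+h≈1 k))) n ⟩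
      (G ⋆ kernel a) n ∎
    where
    p₊ = pow R 1#
    p₋ = pow R (- 1#)
    b = 1# + - a

  identity-i : ∀ h → h + h ≈ 1# → ∀ a n x →
      (a * h) * (Epoly R a n (x + 1#) + Epoly R a n (x + (- 1#))) + (1# + (- a)) * Epoly R a n x
      ≈ pow R x n
  identity-i h h+h≈1 a n x = begin
      (a * h) * (Epoly R a n (x + 1#) + Epoly R a n (x + (- 1#))) + (1# + (- a)) * Epoly R a n x
    ≈⟨ +-cong (*-congˡ (+-cong (translate 1#) (translate (- 1#)))) (*-congˡ (sym (⋆-identityʳ n Ex))) ⟩
      (a * h) * ((Ex ⋆ pow R 1#) n + (Ex ⋆ pow R (- 1#)) n) + (1# + (- a)) * (Ex ⋆ δ) n
    ≈⟨ ⋆kernel h h+h≈1 a Ex n ⟩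
      (Ex ⋆ kernel a) n
    ≈⟨ ⋆-comm n Ex (kernel a) ⟩
      (kernel a ⋆ Ex) n
    ≈⟨ kernel⋆E⋆ a (pow R x) n ⟩
      pow R x n ∎
    where
    Ex = Eseq R a ⋆ pow R x
    translate : ∀ z → Epoly R a n (x + z) ≈ (Ex ⋆ pow R z) n
    translate z = trans (⋆-cong {f = Eseq R a} (λ _ → refl) (λ k → binomial-theorem k x z) n)
                        (sym (⋆-assoc n (Eseq R a) (pow R x) (pow R z)))

  identity-ii : ∀ h → h + h ≈ 1# → ∀ a n x y →
      Σ₀ R n (λ k → binom R n k * (Epoly R a (n ℕ.∸ k) x *
            (((a * h) * (pow R (y + 1#) k + pow R (y + (- 1#)) k)) + ((1# + (- a)) * pow R y k))))
      ≈ pow R (x + y) n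
  identity-ii h h+h≈1 a n x y = begin
      Σ₀ R n (λ k → binom R n k * (Ex (n ℕ.∸ k) * w k))
    ≈⟨ Σ₀-cong n (λ k → *-congˡ (*-comm _ _)) ⟩
      (w ⋆ Ex) n
    ≈⟨ ⋆-cong {g = Ex} w-as-kernel (λ _ → refl) n ⟩
      ((pow R y ⋆ kernel a) ⋆ Ex) n
    ≈⟨ ⋆-assoc n (pow R y) (kernel a) Ex ⟩
      (pow R y ⋆ (kernel a ⋆ Ex)) n
    ≈⟨ ⋆-cong {f = pow R y} (λ _ → refl) (kernel⋆E⋆ a (pow R x)) n ⟩
      (pow R y ⋆ pow R x) n
    ≈⟨ ⋆-comm n (pow R y) (pow R x) ⟩
      (pow R x ⋆ pow R y) n
    ≈⟨ binomial-theorem n x y ⟨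
      pow R (x + y) n ∎
    where
    Ex = Eseq R a ⋆ pow R x
    w : Seq
    w k = ((a * h) * (pow R (y + 1#) k + pow R (y + (- 1#)) k)) + ((1# + (- a)) * pow R y k)
    w-as-kernel : ∀ k → w k ≈ (pow R y ⋆ kernel a) k
    w-as-kernel k = trans
      (+-cong (*-congˡ (+-cong (binomial-theorem k y 1#) (binomial-theorem k y (- 1#))))
              (*-congˡ (sym (⋆-identityʳ k (pow R y)))))
      (⋆kernel h h+h≈1 a (pow R y) k)

  identity-iii : ∀ a n → 1 ℕ.≤ n → ∀ x →
      Epoly R a n x ≈ pow R x n + - (a * evenSum n (λ k → Epoly R a k x))
  identity-iii a (suc m) _ x = begin
      Ex (suc m)
    ≈⟨ trans (+-assoc _ _ _) (trans (+-congˡ (-‿inverseʳ _)) (+-identityʳ _)) ⟨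
      (Ex (suc m) + a * evenSum (suc m) Ex) + - (a * evenSum (suc m) Ex)
    ≈⟨ +-congʳ (kernel⋆-suc a Ex m) ⟨
      (kernel a ⋆ Ex) (suc m) + - (a * evenSum (suc m) Ex)
    ≈⟨ +-congʳ (kernel⋆E⋆ a (pow R x) (suc m)) ⟩
      pow R x (suc m) + - (a * evenSum (suc m) Ex) ∎
    where
    Ex = Eseq R a ⋆ pow R x

theorem2p2 : {c ℓ : Level} (R : CommutativeRing c ℓ) →
    let open CommutativeRing R in
    (h : Carrier) → h + h ≈ 1# →
    (a : Carrier) (n : ℕ) → 1 ℕ.≤ n → (x y : Carrier) →
      ((a * h) * (Epoly R a n (x + 1#) + Epoly R a n (x + (- 1#)))
         + ((1# + (- a)) * Epoly R a n x) ≈ pow R x n)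
      × (Σ₀ R n (λ k → binom R n k * (Epoly R a (n ℕ.∸ k) x *
            (((a * h) * (pow R (y + 1#) k + pow R (y + (- 1#)) k))
               + ((1# + (- a)) * pow R y k))))
          ≈ pow R (x + y) n)
      × (Epoly R a n x ≈
           pow R x n + (- (a * Σ₁ R ℕ.⌊ n /2⌋ (λ k → binom R n (k ℕ.+ k) * Epoly R a (n ℕ.∸ (k ℕ.+ k)) x))))
theorem2p2 R h h+h≈1 a n 1≤n x y =
    identity-i h h+h≈1 a n x
  , identity-ii h h+h≈1 a n x y
  , identity-iii a n 1≤n x
  where open Development R
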